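{- Let $m\geq 13$ and $k\geq1$ be integers and let $c(x)=1+\sum_{j\in\{2,3,6\}}(x^j+x^{m-j})\in\mathbb{F}_2[x]$. Then $\gcd(c(x^k),x^m-1)=1$ in $\mathbb{F}_2[x]$ if and only if $\gcd(m,3k)=\gcd(m,7k)=\gcd(m,k)$.
   Context: In the paper's terminology this says $\{2,3,6\}$ is a QBF-set with respect to $(n,k)$, $n=em$: a set $\mathcal{C}\subseteq\{1,\dots,\lfloor\frac{m-1}{2}\rfloor\}$ is a QBF-set if $c(x)=1+\sum_{j\in\mathcal{C}}(x^j+x^{m-j})$ satisfies $\gcd(c(x^k),x^m-1)=1$ over $\mathbb{F}_2$. -}

module Defs where

open import Data.Bool using (Bool; true; false; _xor_; _∧_)
open import Data.List using (List; []; _∷_; _++_; replicate; map)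
open import Data.Nat using (ℕ; zero; suc; _∸_)
open import Data.Product using (∃)
open import Relation.Binary.PropositionalEquality using (_≡_)

-- Polynomials over F₂ = Bool (xor, ∧), as coefficient lists, lowest degree first.
-- Equality of polynomials is coefficientwise (so trailing zeros are irrelevant).
Poly : Set
Poly = List Bool

coeff : Poly → ℕ → Bool
coeff []      _       = false
coeff (a ∷ p) zero    = a
coeff (a ∷ p) (suc i) = coeff p i

infix 4 _≈ᴾ_
_≈ᴾ_ : Poly → Poly → Set
p ≈ᴾ q = ∀ i → coeff p i ≡ coeff q i

infixl 6 _+ᴾ_
_+ᴾ_ : Poly → Poly → Poly
[]      +ᴾ q       = q
(a ∷ p) +ᴾ []      = a ∷ p
(a ∷ p) +ᴾ (b ∷ q) = (a xor b) ∷ (p +ᴾ q)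

infixl 7 _*ᴾ_
_*ᴾ_ : Poly → Poly → Poly
[]      *ᴾ q = []
(a ∷ p) *ᴾ q = map (a ∧_) q +ᴾ (false ∷ (p *ᴾ q))

oneᴾ : Poly
oneᴾ = true ∷ []

X^ : ℕ → Poly
X^ n = replicate n false ++ (true ∷ [])

infix 4 _∣ᴾ_
_∣ᴾ_ : Poly → Poly → Set
d ∣ᴾ p = ∃ λ q → q *ᴾ d ≈ᴾ p

-- gcd(a , b) = 1 : every common divisor divides 1 (units of F₂[x] are just 1)
GcdOne : Poly → Poly → Set
GcdOne a b = ∀ d → d ∣ᴾ a → d ∣ᴾ b → d ∣ᴾ oneᴾ

subst^ : ℕ → Poly → Poly
subst^ k []      = []
subst^ k (a ∷ p) = (a ∷ []) +ᴾ X^ k *ᴾ subst^ k p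

cpoly : ℕ → Poly
cpoly m = oneᴾ +ᴾ (X^ 2 +ᴾ X^ (m ∸ 2)) +ᴾ (X^ 3 +ᴾ X^ (m ∸ 3)) +ᴾ (X^ 6 +ᴾ X^ (m ∸ 6))

-- Write z = x^k and Φₙ(z) = geom z n = 1 + z + ⋯ + z^(n−1).
-- Modulo any divisor D of x^m + 1 we have z^m = 1, and then z⁶·c(z) ≡ Φ₃(z)³Φ₇(z) with z⁶
-- invertible, so D divides c(x^k) exactly when it divides Φ₃(z)³Φ₇(z).
-- If gcd(m, pk) = gcd(m, k) for p = 3, 7, then z is a power of z^p modulo D; since
-- (z + 1)Φ_p(z) = z^p + 1 and Φ_p(z) ≡ 1 modulo z + 1 (p odd), this makes Φ_p(z) invertible
-- modulo D, so D divides 1.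
-- Conversely, if gcd(m, pk) ≠ g = gcd(m, k) for the prime p, then pg ∣ m and k = rg with p ∤ r.
-- The nonconstant polynomial P = Φ_p(x^g) divides x^(pg) + 1, hence x^m + 1; modulo P, x^g is a
-- power of z = (x^g)^r, which forces (x^g + 1)Φ_p(z) ≡ 0, and x^g + 1 is invertible modulo P.
-- So Φ_p(z) ≡ 0 and P is a nonunit common divisor of c(x^k) and x^m + 1.

module Submission where

open import Data.Nat using (ℕ; _≤_; _*_)
open import Data.Nat.GCD using (gcd)
open import Data.Product using (_×_)
open import Function.Bundles using (_⇔_)
open import Relation.Binary.PropositionalEquality using (_≡_)
open import Defs

open import Algebra.Bundles using (CommutativeMonoid; CommutativeRing)
import Algebra.Properties.CommutativeSemigroup as CommSemigroupProperties
open import Data.Bool using (Bool; true; false; _xor_; _∧_)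
open import Data.Bool.Properties
  using (xor-identityʳ; xor-comm; xor-assoc; xor-same; ∧-comm; ∧-assoc; ∧-distribˡ-xor; ∧-zeroʳ)
open import Data.List using ([]; _∷_; map)
open import Data.Maybe as Maybe using (Maybe; just; nothing)
open import Data.Nat using (zero; suc; _+_; _∸_; z≤n; s≤s; NonZero; ≢-nonZero; ≢-nonZero⁻¹; >-nonZero; _≟_)
import Data.Nat.Properties as ℕ
open import Data.Nat.Divisibility
  using (_∣_; divides; ∣-refl; ∣n⇒∣m*n; *-monoˡ-∣; *-cancelʳ-∣; ∣1⇒≡1)
open import Data.Nat.GCD
  using (gcd[m,n]∣m; gcd[m,n]∣n; gcd-greatest; gcd[m,n]≢0; c*gcd[m,n]≡gcd[cm,cn]; gcd-GCD; module Bézout)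
open import Data.Nat.Primality using (Prime; prime⇒irreducible; ¬prime[1]; prime?)
import Data.Nat.Tactic.RingSolver as ℕ-Solver
open import Data.Product using (_,_; ∃; ∃₂)
open import Data.Sum using (_⊎_; inj₁; inj₂)
open import Function using (id)
open import Function.Bundles using (mk⇔; Equivalence)
open import Level using (0ℓ)
open import Relation.Binary.Bundles using (Setoid)
open import Relation.Binary.PropositionalEquality as ≡ using (_≢_; refl; cong; cong₂)
import Relation.Binary.Reasoning.Setoid as SetoidReasoning
open import Relation.Nullary using (¬_; contradiction)
open import Relation.Nullary.Decidable using (decidable-stable; from-yes)
open import Tactic.RingSolver using (solve-∀; solve)
open import Tactic.RingSolver.Core.AlmostCommutativeRing using (AlmostCommutativeRing; fromCommutativeRing)

-- F₂[x] as a commutative ring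

coeff-+ᴾ : ∀ p q i → coeff (p +ᴾ q) i ≡ coeff p i xor coeff q i
coeff-+ᴾ []      q       i       = refl
coeff-+ᴾ (a ∷ p) []      i       = ≡.sym (xor-identityʳ _)
coeff-+ᴾ (a ∷ p) (b ∷ q) zero    = refl
coeff-+ᴾ (a ∷ p) (b ∷ q) (suc i) = coeff-+ᴾ p q i

infixr 7 _·ᴾ_
_·ᴾ_ : Bool → Poly → Poly
a ·ᴾ p = map (a ∧_) p

coeff-·ᴾ : ∀ a p i → coeff (a ·ᴾ p) i ≡ a ∧ coeff p i
coeff-·ᴾ a []      i       = ≡.sym (∧-zeroʳ a)
coeff-·ᴾ a (b ∷ p) zero    = refl
coeff-·ᴾ a (b ∷ p) (suc i) = coeff-·ᴾ a p i

-- A record rather than _≈ᴾ_ itself, so that the two polynomials can be inferred from a proof.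
infix 4 _≋_
record _≋_ (p q : Poly) : Set where
  constructor coeffwise
  field coeff-≡ : p ≈ᴾ q
open _≋_ public

≋-setoid : Setoid 0ℓ 0ℓ
≋-setoid = record
  { Carrier       = Poly
  ; _≈_           = _≋_
  ; isEquivalence = record
    { refl  = coeffwise λ _ → refl
    ; sym   = λ (coeffwise e) → coeffwise λ i → ≡.sym (e i)
    ; trans = λ (coeffwise e) (coeffwise f) → coeffwise λ i → ≡.trans (e i) (f i)
    }
  }

open Setoid ≋-setoid public using () renaming (refl to ≋-refl; reflexive to ≋-reflexive; sym to ≋-sym; trans to ≋-trans)

+ᴾ-pointwise : ∀ p q r s → (∀ i → coeff p i xor coeff q i ≡ coeff r i xor coeff s i) → p +ᴾ q ≋ r +ᴾ s
+ᴾ-pointwise p q r s e = coeffwise λ i →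
  ≡.trans (coeff-+ᴾ p q i) (≡.trans (e i) (≡.sym (coeff-+ᴾ r s i)))

+ᴾ-cong : ∀ {p p′ q q′} → p ≋ p′ → q ≋ q′ → p +ᴾ q ≋ p′ +ᴾ q′
+ᴾ-cong {p} {p′} {q} {q′} (coeffwise e) (coeffwise f) = +ᴾ-pointwise p q p′ q′ λ i → cong₂ _xor_ (e i) (f i)

+ᴾ-comm : ∀ p q → p +ᴾ q ≋ q +ᴾ p
+ᴾ-comm p q = +ᴾ-pointwise p q q p λ i → xor-comm (coeff p i) (coeff q i)

+ᴾ-assoc : ∀ p q r → p +ᴾ q +ᴾ r ≋ p +ᴾ (q +ᴾ r)
+ᴾ-assoc p q r = coeffwise λ i → begin
  coeff (p +ᴾ q +ᴾ r) i                    ≡⟨ coeff-+ᴾ (p +ᴾ q) r i ⟩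
  coeff (p +ᴾ q) i xor coeff r i           ≡⟨ cong (_xor coeff r i) (coeff-+ᴾ p q i) ⟩
  (coeff p i xor coeff q i) xor coeff r i  ≡⟨ xor-assoc (coeff p i) _ _ ⟩
  coeff p i xor (coeff q i xor coeff r i)  ≡⟨ cong (coeff p i xor_) (coeff-+ᴾ q r i) ⟨
  coeff p i xor coeff (q +ᴾ r) i           ≡⟨ coeff-+ᴾ p (q +ᴾ r) i ⟨
  coeff (p +ᴾ (q +ᴾ r)) i                  ∎
  where open ≡.≡-Reasoning

+ᴾ-identityʳ : ∀ p → p +ᴾ [] ≋ p
+ᴾ-identityʳ p = coeffwise λ i → ≡.trans (coeff-+ᴾ p [] i) (xor-identityʳ (coeff p i))

+ᴾ-self : ∀ p → p +ᴾ p ≋ []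
+ᴾ-self p = coeffwise λ i → ≡.trans (coeff-+ᴾ p p i) (xor-same (coeff p i))

∷-cong : ∀ {a b p q} → a ≡ b → p ≋ q → a ∷ p ≋ b ∷ q
∷-cong a≡b (coeffwise e) = coeffwise λ { zero → a≡b ; (suc i) → e i }

∷-congʳ : ∀ {a p q} → p ≋ q → a ∷ p ≋ a ∷ q
∷-congʳ = ∷-cong refl

-- `false ∷ p` is x·p.
x·[] : false ∷ [] ≋ []
x·[] = coeffwise λ { zero → refl ; (suc i) → refl }

·ᴾ-cong : ∀ a {p q} → p ≋ q → a ·ᴾ p ≋ a ·ᴾ q
·ᴾ-cong a {p} {q} (coeffwise e) = coeffwise λ i →
  ≡.trans (coeff-·ᴾ a p i) (≡.trans (cong (a ∧_) (e i)) (≡.sym (coeff-·ᴾ a q i)))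

·ᴾ-distrib-+ᴾ : ∀ a p q → a ·ᴾ (p +ᴾ q) ≋ a ·ᴾ p +ᴾ a ·ᴾ q
·ᴾ-distrib-+ᴾ a p q = coeffwise λ i → begin
  coeff (a ·ᴾ (p +ᴾ q)) i                ≡⟨ coeff-·ᴾ a (p +ᴾ q) i ⟩
  a ∧ coeff (p +ᴾ q) i                   ≡⟨ cong (a ∧_) (coeff-+ᴾ p q i) ⟩
  a ∧ (coeff p i xor coeff q i)          ≡⟨ ∧-distribˡ-xor a (coeff p i) _ ⟩
  a ∧ coeff p i xor a ∧ coeff q i        ≡⟨ cong₂ _xor_ (coeff-·ᴾ a p i) (coeff-·ᴾ a q i) ⟨
  coeff (a ·ᴾ p) i xor coeff (a ·ᴾ q) i  ≡⟨ coeff-+ᴾ (a ·ᴾ p) _ i ⟨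
  coeff (a ·ᴾ p +ᴾ a ·ᴾ q) i             ∎
  where open ≡.≡-Reasoning

·ᴾ-·ᴾ : ∀ a b p → a ·ᴾ (b ·ᴾ p) ≋ (a ∧ b) ·ᴾ p
·ᴾ-·ᴾ a b p = coeffwise λ i → begin
  coeff (a ·ᴾ (b ·ᴾ p)) i  ≡⟨ coeff-·ᴾ a (b ·ᴾ p) i ⟩
  a ∧ coeff (b ·ᴾ p) i     ≡⟨ cong (a ∧_) (coeff-·ᴾ b p i) ⟩
  a ∧ (b ∧ coeff p i)      ≡⟨ ∧-assoc a b (coeff p i) ⟨
  (a ∧ b) ∧ coeff p i      ≡⟨ coeff-·ᴾ (a ∧ b) p i ⟨
  coeff ((a ∧ b) ·ᴾ p) i   ∎
  where open ≡.≡-Reasoning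

false-·ᴾ : ∀ p → false ·ᴾ p ≋ []
false-·ᴾ p = coeffwise (coeff-·ᴾ false p)

true-·ᴾ : ∀ p → true ·ᴾ p ≋ p
true-·ᴾ p = coeffwise (coeff-·ᴾ true p)

*ᴾ-congˡ : ∀ p {q q′} → q ≋ q′ → p *ᴾ q ≋ p *ᴾ q′
*ᴾ-congˡ []      e = ≋-refl
*ᴾ-congˡ (a ∷ p) e = +ᴾ-cong (·ᴾ-cong a e) (∷-congʳ (*ᴾ-congˡ p e))

*ᴾ-zeroʳ : ∀ p → p *ᴾ [] ≋ []
*ᴾ-zeroʳ []      = ≋-refl
*ᴾ-zeroʳ (a ∷ p) = ≋-trans (∷-congʳ (*ᴾ-zeroʳ p)) x·[]

+ᴾ-commutativeMonoid : CommutativeMonoid 0ℓ 0ℓ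
+ᴾ-commutativeMonoid = record
  { _≈_ = _≋_
  ; _∙_ = _+ᴾ_
  ; ε   = []
  ; isCommutativeMonoid = record
    { isMonoid = record
      { isSemigroup = record
        { isMagma = record { isEquivalence = Setoid.isEquivalence ≋-setoid ; ∙-cong = +ᴾ-cong }
        ; assoc   = +ᴾ-assoc }
      ; identity = (λ _ → ≋-refl) , +ᴾ-identityʳ }
    ; comm = +ᴾ-comm }
  }

open CommSemigroupProperties (CommutativeMonoid.commutativeSemigroup +ᴾ-commutativeMonoid)
  using (interchange; x∙yz≈y∙xz)

*ᴾ-∷ʳ : ∀ p b q → p *ᴾ (b ∷ q) ≋ b ·ᴾ p +ᴾ (false ∷ p *ᴾ q)
*ᴾ-∷ʳ []      b q = ≋-sym x·[]
*ᴾ-∷ʳ (a ∷ p) b q = ∷-cong (cong (_xor false) (∧-comm a b)) (begin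
  a ·ᴾ q +ᴾ p *ᴾ (b ∷ q)                   ≈⟨ +ᴾ-cong ≋-refl (*ᴾ-∷ʳ p b q) ⟩
  a ·ᴾ q +ᴾ (b ·ᴾ p +ᴾ (false ∷ p *ᴾ q))   ≈⟨ x∙yz≈y∙xz (a ·ᴾ q) (b ·ᴾ p) _ ⟩
  b ·ᴾ p +ᴾ (a ·ᴾ q +ᴾ (false ∷ p *ᴾ q))   ∎)
  where open SetoidReasoning ≋-setoid

*ᴾ-comm : ∀ p q → p *ᴾ q ≋ q *ᴾ p
*ᴾ-comm []      q = ≋-sym (*ᴾ-zeroʳ q)
*ᴾ-comm (a ∷ p) q = begin
  a ·ᴾ q +ᴾ (false ∷ p *ᴾ q)  ≈⟨ +ᴾ-cong ≋-refl (∷-congʳ (*ᴾ-comm p q)) ⟩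
  a ·ᴾ q +ᴾ (false ∷ q *ᴾ p)  ≈⟨ *ᴾ-∷ʳ q a p ⟨
  q *ᴾ (a ∷ p)                ∎
  where open SetoidReasoning ≋-setoid

*ᴾ-congʳ : ∀ q {p p′} → p ≋ p′ → p *ᴾ q ≋ p′ *ᴾ q
*ᴾ-congʳ q {p} {p′} e = ≋-trans (*ᴾ-comm p q) (≋-trans (*ᴾ-congˡ q e) (*ᴾ-comm q p′))

*ᴾ-cong : ∀ {p p′ q q′} → p ≋ p′ → q ≋ q′ → p *ᴾ q ≋ p′ *ᴾ q′
*ᴾ-cong {p′ = p′} {q} e f = ≋-trans (*ᴾ-congʳ q e) (*ᴾ-congˡ p′ f)

*ᴾ-distribˡ : ∀ p q r → p *ᴾ (q +ᴾ r) ≋ p *ᴾ q +ᴾ p *ᴾ r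
*ᴾ-distribˡ []      q r = ≋-refl
*ᴾ-distribˡ (a ∷ p) q r = begin
  a ·ᴾ (q +ᴾ r) +ᴾ (false ∷ p *ᴾ (q +ᴾ r))
    ≈⟨ +ᴾ-cong (·ᴾ-distrib-+ᴾ a q r) (∷-congʳ (*ᴾ-distribˡ p q r)) ⟩
  (a ·ᴾ q +ᴾ a ·ᴾ r) +ᴾ ((false ∷ p *ᴾ q) +ᴾ (false ∷ p *ᴾ r))
    ≈⟨ interchange (a ·ᴾ q) (a ·ᴾ r) (false ∷ p *ᴾ q) _ ⟩
  (a ·ᴾ q +ᴾ (false ∷ p *ᴾ q)) +ᴾ (a ·ᴾ r +ᴾ (false ∷ p *ᴾ r))
    ∎
  where open SetoidReasoning ≋-setoid

*ᴾ-distribʳ : ∀ p q r → (q +ᴾ r) *ᴾ p ≋ q *ᴾ p +ᴾ r *ᴾ p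
*ᴾ-distribʳ p q r = begin
  (q +ᴾ r) *ᴾ p        ≈⟨ *ᴾ-comm (q +ᴾ r) p ⟩
  p *ᴾ (q +ᴾ r)        ≈⟨ *ᴾ-distribˡ p q r ⟩
  p *ᴾ q +ᴾ p *ᴾ r     ≈⟨ +ᴾ-cong (*ᴾ-comm p q) (*ᴾ-comm p r) ⟩
  q *ᴾ p +ᴾ r *ᴾ p     ∎
  where open SetoidReasoning ≋-setoid

·ᴾ-*ᴾ : ∀ a p q → (a ·ᴾ p) *ᴾ q ≋ a ·ᴾ (p *ᴾ q)
·ᴾ-*ᴾ a []      q = ≋-refl
·ᴾ-*ᴾ a (b ∷ p) q = begin
  (a ∧ b) ·ᴾ q +ᴾ (false ∷ (a ·ᴾ p) *ᴾ q)   ≈⟨ +ᴾ-cong (≋-sym (·ᴾ-·ᴾ a b q)) (∷-cong (≡.sym (∧-zeroʳ a)) (·ᴾ-*ᴾ a p q)) ⟩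
  a ·ᴾ b ·ᴾ q +ᴾ a ·ᴾ (false ∷ p *ᴾ q)      ≈⟨ ·ᴾ-distrib-+ᴾ a (b ·ᴾ q) _ ⟨
  a ·ᴾ (b ·ᴾ q +ᴾ (false ∷ p *ᴾ q))        ∎
  where open SetoidReasoning ≋-setoid

x·-*ᴾ : ∀ p q → (false ∷ p) *ᴾ q ≋ false ∷ p *ᴾ q
x·-*ᴾ p q = +ᴾ-cong (false-·ᴾ q) ≋-refl

*ᴾ-assoc : ∀ p q r → p *ᴾ q *ᴾ r ≋ p *ᴾ (q *ᴾ r)
*ᴾ-assoc []      q r = ≋-refl
*ᴾ-assoc (a ∷ p) q r = begin
  (a ·ᴾ q +ᴾ (false ∷ p *ᴾ q)) *ᴾ r           ≈⟨ *ᴾ-distribʳ r (a ·ᴾ q) _ ⟩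
  (a ·ᴾ q) *ᴾ r +ᴾ (false ∷ p *ᴾ q) *ᴾ r      ≈⟨ +ᴾ-cong (·ᴾ-*ᴾ a q r) (x·-*ᴾ (p *ᴾ q) r) ⟩
  a ·ᴾ (q *ᴾ r) +ᴾ (false ∷ p *ᴾ q *ᴾ r)      ≈⟨ +ᴾ-cong ≋-refl (∷-congʳ (*ᴾ-assoc p q r)) ⟩
  a ·ᴾ (q *ᴾ r) +ᴾ (false ∷ p *ᴾ (q *ᴾ r))    ∎
  where open SetoidReasoning ≋-setoid

*ᴾ-identityˡ : ∀ p → oneᴾ *ᴾ p ≋ p
*ᴾ-identityˡ p = ≋-trans (+ᴾ-cong (true-·ᴾ p) x·[]) (+ᴾ-identityʳ p)

F₂[x] : CommutativeRing 0ℓ 0ℓ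
F₂[x] = record
  { Carrier = Poly
  ; _≈_ = _≋_
  ; _+_ = _+ᴾ_
  ; _*_ = _*ᴾ_
  ; -_  = id
  ; 0#  = []
  ; 1#  = oneᴾ
  ; isCommutativeRing = record
    { isRing = record
      { +-isAbelianGroup = record
        { isGroup = record
          { isMonoid = CommutativeMonoid.isMonoid +ᴾ-commutativeMonoid
          ; inverse  = +ᴾ-self , +ᴾ-self
          ; ⁻¹-cong  = id }
        ; comm = +ᴾ-comm }
      ; *-cong     = *ᴾ-cong
      ; *-assoc    = *ᴾ-assoc
      ; *-identity = *ᴾ-identityˡ , λ p → ≋-trans (*ᴾ-comm p oneᴾ) (*ᴾ-identityˡ p)
      ; distrib    = *ᴾ-distribˡ , *ᴾ-distribʳ }
    ; *-comm = *ᴾ-comm }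
  }

[]≟ᴾ_ : ∀ p → Maybe ([] ≋ p)
[]≟ᴾ []          = just ≋-refl
[]≟ᴾ (true ∷ p)  = nothing
[]≟ᴾ (false ∷ p) with []≟ᴾ p
... | just e  = just (≋-trans (≋-sym x·[]) (∷-congʳ e))
... | nothing = nothing

F₂[x]-solver : AlmostCommutativeRing 0ℓ 0ℓ
F₂[x]-solver = fromCommutativeRing F₂[x] []≟ᴾ_

-- The ring solver only recognises powers built with its own `_^_`, so all powers use it.
open AlmostCommutativeRing F₂[x]-solver public using (_^_)

open import Algebra.Properties.CommutativeSemiring.Exp.TCOptimised (CommutativeRing.commutativeSemiring F₂[x])
  using (^-homo-*; ^-assocʳ)

-- Monomials, the substitution x ↦ x^k, geometric sums

x : Poly
x = X^ 1

x*ᴾ : ∀ p → x *ᴾ p ≋ false ∷ p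
x*ᴾ p = +ᴾ-cong (false-·ᴾ p) (∷-congʳ (*ᴾ-identityˡ p))

X^≋x^ : ∀ n → X^ n ≋ x ^ n
X^≋x^ zero    = ≋-refl
X^≋x^ (suc n) = begin
  false ∷ X^ n   ≈⟨ ∷-congʳ (X^≋x^ n) ⟩
  false ∷ x ^ n  ≈⟨ x*ᴾ (x ^ n) ⟨
  x *ᴾ x ^ n     ≈⟨ ^-homo-* x 1 n ⟨
  x ^ suc n      ∎
  where open SetoidReasoning ≋-setoid

X^-* : ∀ a b → X^ (b * a) ≋ (x ^ a) ^ b
X^-* a b = ≋-trans (X^≋x^ (b * a)) (≋-trans (≋-reflexive (cong (x ^_) (ℕ.*-comm b a))) (≋-sym (^-assocʳ x a b)))

subst^-+ᴾ : ∀ k p q → subst^ k (p +ᴾ q) ≋ subst^ k p +ᴾ subst^ k q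
subst^-+ᴾ k []      q       = ≋-refl
subst^-+ᴾ k (a ∷ p) []      = ≋-sym (+ᴾ-identityʳ _)
subst^-+ᴾ k (a ∷ p) (b ∷ q) = begin
  ((a xor b) ∷ []) +ᴾ z *ᴾ subst^ k (p +ᴾ q)                       ≈⟨ +ᴾ-cong ≋-refl (*ᴾ-congˡ z (subst^-+ᴾ k p q)) ⟩
  (a ∷ []) +ᴾ (b ∷ []) +ᴾ z *ᴾ (subst^ k p +ᴾ subst^ k q)        ≈⟨ rearrange (a ∷ []) (b ∷ []) z _ _ ⟩
  ((a ∷ []) +ᴾ z *ᴾ subst^ k p) +ᴾ ((b ∷ []) +ᴾ z *ᴾ subst^ k q) ∎
  where
  open SetoidReasoning ≋-setoid
  z = X^ k
  rearrange : ∀ A B z P Q → A +ᴾ B +ᴾ z *ᴾ (P +ᴾ Q) ≋ (A +ᴾ z *ᴾ P) +ᴾ (B +ᴾ z *ᴾ Q)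
  rearrange = solve-∀ F₂[x]-solver

subst^-X^ : ∀ k n → subst^ k (X^ n) ≋ (x ^ k) ^ n
subst^-X^ k zero    = ≋-trans (+ᴾ-cong ≋-refl (*ᴾ-zeroʳ (X^ k))) (+ᴾ-identityʳ oneᴾ)
subst^-X^ k (suc n) = begin
  (false ∷ []) +ᴾ X^ k *ᴾ subst^ k (X^ n)  ≈⟨ +ᴾ-cong x·[] (*ᴾ-cong (X^≋x^ k) (subst^-X^ k n)) ⟩
  x ^ k *ᴾ (x ^ k) ^ n                       ≈⟨ ^-homo-* (x ^ k) 1 n ⟨
  (x ^ k) ^ suc n                            ∎
  where open SetoidReasoning ≋-setoid

c[_] : ℕ → Poly → Poly
c[ m ] z = oneᴾ +ᴾ (z ^ 2 +ᴾ z ^ (m ∸ 2)) +ᴾ (z ^ 3 +ᴾ z ^ (m ∸ 3)) +ᴾ (z ^ 6 +ᴾ z ^ (m ∸ 6))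

subst^-cpoly : ∀ m k → subst^ k (cpoly m) ≋ c[ m ] (x ^ k)
subst^-cpoly m k =
  ≋-trans (subst^-+ᴾ k (oneᴾ +ᴾ P 2 +ᴾ P 3) (P 6)) (+ᴾ-cong
    (≋-trans (subst^-+ᴾ k (oneᴾ +ᴾ P 2) (P 3)) (+ᴾ-cong
      (≋-trans (subst^-+ᴾ k oneᴾ (P 2)) (+ᴾ-cong (subst^-X^ k 0) (pair 2)))
      (pair 3)))
    (pair 6))
  where
  P : ℕ → Poly
  P j = X^ j +ᴾ X^ (m ∸ j)
  pair : ∀ j → subst^ k (X^ j +ᴾ X^ (m ∸ j)) ≋ (x ^ k) ^ j +ᴾ (x ^ k) ^ (m ∸ j)
  pair j = ≋-trans (subst^-+ᴾ k (X^ j) _) (+ᴾ-cong (subst^-X^ k j) (subst^-X^ k (m ∸ j)))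

oneᴾ^≋oneᴾ : ∀ n → oneᴾ ^ n ≋ oneᴾ
oneᴾ^≋oneᴾ n = ^-assocʳ oneᴾ 0 n

geom : Poly → ℕ → Poly
geom y zero    = []
geom y (suc n) = geom y n +ᴾ y ^ n

*ᴾ-geom : ∀ y n → (y +ᴾ oneᴾ) *ᴾ geom y n ≋ y ^ n +ᴾ oneᴾ
*ᴾ-geom y zero    = ≋-trans (*ᴾ-zeroʳ (y +ᴾ oneᴾ)) (≋-sym (+ᴾ-self oneᴾ))
*ᴾ-geom y (suc n) = begin
  (y +ᴾ oneᴾ) *ᴾ (geom y n +ᴾ y ^ n)               ≈⟨ *ᴾ-distribˡ (y +ᴾ oneᴾ) _ _ ⟩
  (y +ᴾ oneᴾ) *ᴾ geom y n +ᴾ (y +ᴾ oneᴾ) *ᴾ y ^ n  ≈⟨ +ᴾ-cong (*ᴾ-geom y n) ≋-refl ⟩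
  y ^ n +ᴾ oneᴾ +ᴾ (y +ᴾ oneᴾ) *ᴾ y ^ n            ≈⟨ telescope y (y ^ n) ⟩
  y *ᴾ y ^ n +ᴾ oneᴾ                               ≈⟨ +ᴾ-cong (^-homo-* y 1 n) ≋-refl ⟨
  y ^ suc n +ᴾ oneᴾ                                ∎
  where
  open SetoidReasoning ≋-setoid
  telescope : ∀ y Y → Y +ᴾ oneᴾ +ᴾ (y +ᴾ oneᴾ) *ᴾ Y ≋ y *ᴾ Y +ᴾ oneᴾ
  telescope = solve-∀ F₂[x]-solver

-- Congruence modulo a polynomial

-- p ≡ q mod D means D ∣ p − q, and p − q = p + q over F₂.
infix 4 ModEq
record ModEq (D p q : Poly) : Set where
  constructor _by_
  field
    quotient   : Poly
    quotient*D : quotient *ᴾ D ≋ p +ᴾ q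

syntax ModEq D p q = p ≡ q mod D

module _ {D : Poly} where

  ≋⇒≡ : ∀ {p q} → p ≋ q → p ≡ q mod D
  ≋⇒≡ {p} {q} p≋q = [] by ≋-sym (≋-trans (+ᴾ-cong p≋q ≋-refl) (+ᴾ-self q))

  ≡-sym : ∀ {p q} → p ≡ q mod D → q ≡ p mod D
  ≡-sym {p} {q} (w by e) = w by ≋-trans e (+ᴾ-comm p q)

  ≡-trans : ∀ {p q r} → p ≡ q mod D → q ≡ r mod D → p ≡ r mod D
  ≡-trans {p} {q} {r} (v by e) (w by f) = (v +ᴾ w) by (begin
    (v +ᴾ w) *ᴾ D           ≈⟨ *ᴾ-distribʳ D v w ⟩
    v *ᴾ D +ᴾ w *ᴾ D        ≈⟨ +ᴾ-cong e f ⟩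
    (p +ᴾ q) +ᴾ (q +ᴾ r)    ≈⟨ solve (p ∷ q ∷ r ∷ []) F₂[x]-solver ⟩
    p +ᴾ r                  ∎)
    where open SetoidReasoning ≋-setoid

  +-cong : ∀ {p q u v} → p ≡ q mod D → u ≡ v mod D → p +ᴾ u ≡ q +ᴾ v mod D
  +-cong {p} {q} {u} {v} (w by e) (w′ by f) = (w +ᴾ w′) by (begin
    (w +ᴾ w′) *ᴾ D          ≈⟨ *ᴾ-distribʳ D w w′ ⟩
    w *ᴾ D +ᴾ w′ *ᴾ D       ≈⟨ +ᴾ-cong e f ⟩
    (p +ᴾ q) +ᴾ (u +ᴾ v)    ≈⟨ solve (p ∷ q ∷ u ∷ v ∷ []) F₂[x]-solver ⟩
    (p +ᴾ u) +ᴾ (q +ᴾ v)    ∎)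
    where open SetoidReasoning ≋-setoid

  *-cong : ∀ {p q u v} → p ≡ q mod D → u ≡ v mod D → p *ᴾ u ≡ q *ᴾ v mod D
  *-cong {p} {q} {u} {v} (w by e) (w′ by f) = (w *ᴾ u +ᴾ q *ᴾ w′) by (begin
    (w *ᴾ u +ᴾ q *ᴾ w′) *ᴾ D        ≈⟨ solve (w ∷ u ∷ q ∷ w′ ∷ D ∷ []) F₂[x]-solver ⟩
    (w *ᴾ D) *ᴾ u +ᴾ q *ᴾ (w′ *ᴾ D)  ≈⟨ +ᴾ-cong (*ᴾ-congʳ u e) (*ᴾ-congˡ q f) ⟩
    (p +ᴾ q) *ᴾ u +ᴾ q *ᴾ (u +ᴾ v)   ≈⟨ solve (p ∷ q ∷ u ∷ v ∷ []) F₂[x]-solver ⟩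
    p *ᴾ u +ᴾ q *ᴾ v                 ∎)
    where open SetoidReasoning ≋-setoid

F₂[x]/⟨_⟩ : Poly → CommutativeRing 0ℓ 0ℓ
F₂[x]/⟨ D ⟩ = record
  { Carrier = Poly
  ; _≈_ = ModEq D
  ; _+_ = _+ᴾ_
  ; _*_ = _*ᴾ_
  ; -_  = id
  ; 0#  = []
  ; 1#  = oneᴾ
  ; isCommutativeRing = record
    { isRing = record
      { +-isAbelianGroup = record
        { isGroup = record
          { isMonoid = record
            { isSemigroup = record
              { isMagma = record
                { isEquivalence = record { refl = ≋⇒≡ ≋-refl ; sym = ≡-sym ; trans = ≡-trans }
                ; ∙-cong = +-cong }
              ; assoc = λ p q r → ≋⇒≡ (F.+-assoc p q r) }
            ; identity = (λ p → ≋⇒≡ (F.+-identityˡ p)) , (λ p → ≋⇒≡ (F.+-identityʳ p)) }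
          ; inverse = (λ p → ≋⇒≡ (F.-‿inverseˡ p)) , (λ p → ≋⇒≡ (F.-‿inverseʳ p))
          ; ⁻¹-cong = id }
        ; comm = λ p q → ≋⇒≡ (F.+-comm p q) }
      ; *-cong = *-cong
      ; *-assoc = λ p q r → ≋⇒≡ (F.*-assoc p q r)
      ; *-identity = (λ p → ≋⇒≡ (F.*-identityˡ p)) , (λ p → ≋⇒≡ (F.*-identityʳ p))
      ; distrib = (λ p q r → ≋⇒≡ (F.distribˡ p q r)) , (λ p q r → ≋⇒≡ (F.distribʳ p q r)) }
    ; *-comm = λ p q → ≋⇒≡ (F.*-comm p q) }
  }
  where module F = CommutativeRing F₂[x]

module Modulo (D : Poly) where
  open CommutativeRing F₂[x]/⟨ D ⟩ public using (setoid; *-identityʳ)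

  *-congˡ : ∀ a {p q} → p ≡ q mod D → a *ᴾ p ≡ a *ᴾ q mod D
  *-congˡ a = *-cong (≋⇒≡ (≋-refl {a}))

  *-congʳ : ∀ a {p q} → p ≡ q mod D → p *ᴾ a ≡ q *ᴾ a mod D
  *-congʳ a e = *-cong e (≋⇒≡ (≋-refl {a}))

  +-congˡ : ∀ a {p q} → p ≡ q mod D → a +ᴾ p ≡ a +ᴾ q mod D
  +-congˡ a = +-cong (≋⇒≡ (≋-refl {a}))

  ^-congˡ : ∀ n {p q} → p ≡ q mod D → p ^ n ≡ q ^ n mod D
  ^-congˡ zero          e = ≋⇒≡ ≋-refl
  ^-congˡ (suc zero)    e = e
  ^-congˡ (suc (suc n)) e = *-cong (^-congˡ (suc n) e) e

  open SetoidReasoning setoid public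

  F₂[x]/D-solver : AlmostCommutativeRing 0ℓ 0ℓ
  F₂[x]/D-solver = fromCommutativeRing F₂[x]/⟨ D ⟩ λ p → Maybe.map ≋⇒≡ ([]≟ᴾ p)

+≡[]⇒≡ : ∀ {D p q} → p +ᴾ q ≡ [] mod D → p ≡ q mod D
+≡[]⇒≡ {p = p} {q} (w by e) = w by ≋-trans e (+ᴾ-identityʳ (p +ᴾ q))

+≡[]⇐≡ : ∀ {D p q} → p ≡ q mod D → p +ᴾ q ≡ [] mod D
+≡[]⇐≡ {p = p} {q} (w by e) = w by ≋-trans e (≋-sym (+ᴾ-identityʳ (p +ᴾ q)))

∣ᴾ⇒≡[] : ∀ {D p} → D ∣ᴾ p → p ≡ [] mod D
∣ᴾ⇒≡[] {p = p} (w , w*D≈p) = w by ≋-trans (coeffwise w*D≈p) (≋-sym (+ᴾ-identityʳ p))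

≡[]⇒∣ᴾ : ∀ {D p} → p ≡ [] mod D → D ∣ᴾ p
≡[]⇒∣ᴾ {p = p} (w by e) = w , coeff-≡ (≋-trans e (+ᴾ-identityʳ p))

∣ᴾX^+1⇔x^≡1 : ∀ {D} n → D ∣ᴾ X^ n +ᴾ oneᴾ ⇔ x ^ n ≡ oneᴾ mod D
∣ᴾX^+1⇔x^≡1 n = mk⇔
  (λ D∣ → ≡-trans (≋⇒≡ (≋-sym (X^≋x^ n))) (+≡[]⇒≡ (∣ᴾ⇒≡[] D∣)))
  (λ x^n≡1 → ≡[]⇒∣ᴾ (≡-trans (+-cong (≡-trans (≋⇒≡ (X^≋x^ n)) x^n≡1) (≋⇒≡ ≋-refl)) (≋⇒≡ (+ᴾ-self oneᴾ))))

^-periodic : ∀ {D} y o a b s t → y ^ o ≡ oneᴾ mod D → a + s * o ≡ b + t * o → y ^ a ≡ y ^ b mod D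
^-periodic {D} y o a b s t y^o≡1 eq = begin
  y ^ a                 ≈⟨ absorb a s ⟨
  y ^ a *ᴾ (y ^ o) ^ s  ≈⟨ ≋⇒≡ (*ᴾ-congˡ (y ^ a) (^-assocʳ y o s)) ⟩
  y ^ a *ᴾ y ^ (o * s)  ≈⟨ ≋⇒≡ (^-homo-* y a (o * s)) ⟨
  y ^ (a + o * s)       ≡⟨ cong (λ e → y ^ (a + e)) (ℕ.*-comm o s) ⟩
  y ^ (a + s * o)       ≡⟨ cong (y ^_) eq ⟩
  y ^ (b + t * o)       ≡⟨ cong (λ e → y ^ (b + e)) (ℕ.*-comm t o) ⟩
  y ^ (b + o * t)       ≈⟨ ≋⇒≡ (^-homo-* y b (o * t)) ⟩
  y ^ b *ᴾ y ^ (o * t)  ≈⟨ ≋⇒≡ (*ᴾ-congˡ (y ^ b) (^-assocʳ y o t)) ⟨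
  y ^ b *ᴾ (y ^ o) ^ t  ≈⟨ absorb b t ⟩
  y ^ b                 ∎
  where
  open Modulo D
  absorb : ∀ e n → y ^ e *ᴾ (y ^ o) ^ n ≡ y ^ e mod D
  absorb e n = begin
    y ^ e *ᴾ (y ^ o) ^ n  ≈⟨ *-congˡ (y ^ e) (^-congˡ n y^o≡1) ⟩
    y ^ e *ᴾ oneᴾ ^ n     ≈⟨ ≋⇒≡ (*ᴾ-congˡ (y ^ e) (oneᴾ^≋oneᴾ n)) ⟩
    y ^ e *ᴾ oneᴾ         ≈⟨ *-identityʳ (y ^ e) ⟩
    y ^ e                 ∎

^^-periodic : ∀ {D} y o a b e s t → y ^ o ≡ oneᴾ mod D → a * b + s * o ≡ e + t * o → (y ^ a) ^ b ≡ y ^ e mod D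
^^-periodic y o a b e s t y^o≡1 eq = ≡-trans (≋⇒≡ (^-assocʳ y a b)) (^-periodic y o (a * b) e s t y^o≡1 eq)

geom-cong : ∀ {D} n {y y′} → y ≡ y′ mod D → geom y n ≡ geom y′ n mod D
geom-cong zero    e = ≋⇒≡ ≋-refl
geom-cong {D} (suc n) e = +-cong (geom-cong n e) (^-congˡ n e)
  where open Modulo D

geom-root : ∀ y n → y ^ n ≡ oneᴾ mod geom y n
geom-root y n = (y +ᴾ oneᴾ) by *ᴾ-geom y n

geom-oneᴾ-odd : ∀ h → geom oneᴾ (suc (h * 2)) ≋ oneᴾ
geom-oneᴾ-odd zero    = ≋-refl
geom-oneᴾ-odd (suc h) = begin
  geom oneᴾ (suc (h * 2)) +ᴾ oneᴾ ^ suc (h * 2) +ᴾ oneᴾ ^ suc (suc (h * 2))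
    ≈⟨ +ᴾ-cong (+ᴾ-cong (geom-oneᴾ-odd h) (oneᴾ^≋oneᴾ (suc (h * 2)))) (oneᴾ^≋oneᴾ (suc (suc (h * 2)))) ⟩
  oneᴾ +ᴾ oneᴾ +ᴾ oneᴾ
    ≈⟨ +ᴾ-cong (+ᴾ-self oneᴾ) ≋-refl ⟩
  oneᴾ ∎
  where open SetoidReasoning ≋-setoid

geom-odd≡1 : ∀ y h → geom y (suc (h * 2)) ≡ oneᴾ mod (y +ᴾ oneᴾ)
geom-odd≡1 y h = begin
  geom y (suc (h * 2))     ≈⟨ geom-cong (suc (h * 2)) y≡1 ⟩
  geom oneᴾ (suc (h * 2))  ≈⟨ ≋⇒≡ (geom-oneᴾ-odd h) ⟩
  oneᴾ                     ∎
  where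
  open Modulo (y +ᴾ oneᴾ)
  y≡1 : y ≡ oneᴾ mod (y +ᴾ oneᴾ)
  y≡1 = oneᴾ by *ᴾ-identityˡ (y +ᴾ oneᴾ)

record Invertible (D a : Poly) : Set where
  constructor _,_
  field
    inverse   : Poly
    inverse-≡ : a *ᴾ inverse ≡ oneᴾ mod D

Invertible-* : ∀ {D a b} → Invertible D a → Invertible D b → Invertible D (a *ᴾ b)
Invertible-* {D} {a} {b} (u , au≡1) (v , bv≡1) = u *ᴾ v , (begin
  a *ᴾ b *ᴾ (u *ᴾ v)    ≈⟨ solve (a ∷ b ∷ u ∷ v ∷ []) F₂[x]/D-solver ⟩
  (a *ᴾ u) *ᴾ (b *ᴾ v)  ≈⟨ *-cong au≡1 bv≡1 ⟩
  oneᴾ *ᴾ oneᴾ          ≈⟨ ≋⇒≡ (*ᴾ-identityˡ oneᴾ) ⟩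
  oneᴾ                  ∎)
  where open Modulo D

invertible-cancel : ∀ {D a b} → Invertible D a → a *ᴾ b ≡ [] mod D → b ≡ [] mod D
invertible-cancel {D} {a} {b} (u , au≡1) ab≡0 = begin
  b                ≈⟨ solve (b ∷ []) F₂[x]/D-solver ⟩
  oneᴾ *ᴾ b        ≈⟨ *-congʳ b au≡1 ⟨
  a *ᴾ u *ᴾ b      ≈⟨ solve (a ∷ u ∷ b ∷ []) F₂[x]/D-solver ⟩
  u *ᴾ (a *ᴾ b)    ≈⟨ *-congˡ u ab≡0 ⟩
  u *ᴾ []          ≈⟨ solve (u ∷ []) F₂[x]/D-solver ⟩
  []               ∎
  where open Modulo D

invertible-if-≡1-mod : ∀ {D Φ f g} → Φ ≡ oneᴾ mod f → f *ᴾ Φ *ᴾ g ≡ f mod D → Invertible D Φ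
invertible-if-≡1-mod {D} {Φ} {f} {g} (r by r*f≋Φ+1) fΦg≡f = oneᴾ +ᴾ r *ᴾ g *ᴾ f , (begin
  Φ *ᴾ (oneᴾ +ᴾ r *ᴾ g *ᴾ f)  ≈⟨ solve (Φ ∷ r ∷ g ∷ f ∷ []) F₂[x]/D-solver ⟩
  Φ +ᴾ r *ᴾ (f *ᴾ Φ *ᴾ g)     ≈⟨ +-congˡ Φ (*-congˡ r fΦg≡f) ⟩
  Φ +ᴾ r *ᴾ f                 ≈⟨ +-congˡ Φ (≋⇒≡ r*f≋Φ+1) ⟩
  Φ +ᴾ (Φ +ᴾ oneᴾ)            ≈⟨ solve (Φ ∷ []) F₂[x]/D-solver ⟩
  oneᴾ                        ∎)
  where open Modulo D

geom-invertible : ∀ {D} z h E → (z ^ suc (h * 2)) ^ E ≡ z mod D → Invertible D (geom z (suc (h * 2)))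
geom-invertible {D} z h E w^E≡z = invertible-if-≡1-mod (geom-odd≡1 z h) (begin
  (z +ᴾ oneᴾ) *ᴾ geom z c *ᴾ geom w E  ≈⟨ ≋⇒≡ (*ᴾ-congʳ (geom w E) (*ᴾ-geom z c)) ⟩
  (w +ᴾ oneᴾ) *ᴾ geom w E              ≈⟨ ≋⇒≡ (*ᴾ-geom w E) ⟩
  w ^ E +ᴾ oneᴾ                        ≈⟨ +-cong w^E≡z (≋⇒≡ ≋-refl) ⟩
  z +ᴾ oneᴾ                            ∎)
  where
  open Modulo D
  c = suc (h * 2)
  w = z ^ c

geom-vanishes : ∀ {D} y w c E → Invertible D (y +ᴾ oneᴾ) →
  w ^ c ≡ oneᴾ mod D → w ^ E ≡ y mod D → geom w c ≡ [] mod D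
geom-vanishes {D} y w c E y+1-invertible w^c≡1 w^E≡y = invertible-cancel y+1-invertible (begin
  (y +ᴾ oneᴾ) *ᴾ geom w c                ≈⟨ *-congʳ (geom w c) (+-cong w^E≡y (≋⇒≡ ≋-refl)) ⟨
  (w ^ E +ᴾ oneᴾ) *ᴾ geom w c            ≈⟨ ≋⇒≡ (*ᴾ-congʳ (geom w c) (*ᴾ-geom w E)) ⟨
  (w +ᴾ oneᴾ) *ᴾ geom w E *ᴾ geom w c    ≈⟨ ≋⇒≡ (swap (w +ᴾ oneᴾ) (geom w E) (geom w c)) ⟩
  geom w E *ᴾ ((w +ᴾ oneᴾ) *ᴾ geom w c)  ≈⟨ ≋⇒≡ (*ᴾ-congˡ (geom w E) (*ᴾ-geom w c)) ⟩
  geom w E *ᴾ (w ^ c +ᴾ oneᴾ)            ≈⟨ *-congˡ (geom w E) (+≡[]⇐≡ w^c≡1) ⟩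
  geom w E *ᴾ []                         ≈⟨ ≋⇒≡ (*ᴾ-zeroʳ (geom w E)) ⟩
  []                                     ∎)
  where
  open Modulo D
  swap : ∀ p q r → p *ᴾ q *ᴾ r ≋ q *ᴾ (p *ᴾ r)
  swap = solve-∀ F₂[x]-solver

y+oneᴾ-invertible : ∀ y h → Invertible (geom y (suc (h * 2))) (y +ᴾ oneᴾ)
y+oneᴾ-invertible y h with geom-odd≡1 y h
... | r by r*[y+1]≋P+1 = r , (begin
  (y +ᴾ oneᴾ) *ᴾ r  ≈⟨ ≋⇒≡ (*ᴾ-comm (y +ᴾ oneᴾ) r) ⟩
  r *ᴾ (y +ᴾ oneᴾ)  ≈⟨ ≋⇒≡ r*[y+1]≋P+1 ⟩
  P +ᴾ oneᴾ         ≈⟨ +-cong P≡0 (≋⇒≡ ≋-refl) ⟩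
  oneᴾ              ∎)
  where
  P = geom y (suc (h * 2))
  open Modulo P
  P≡0 : P ≡ [] mod P
  P≡0 = oneᴾ by ≋-trans (*ᴾ-identityˡ P) (≋-sym (+ᴾ-identityʳ P))

-- With a, b, c = z^(m−2), z^(m−3), z^(m−6), each bracket on the right vanishes once z^m = 1.
c-identity : ∀ z a b c →
  z ^ 6 *ᴾ (oneᴾ +ᴾ (z ^ 2 +ᴾ a) +ᴾ (z ^ 3 +ᴾ b) +ᴾ (z ^ 6 +ᴾ c))
    ≋ (oneᴾ +ᴾ z +ᴾ z ^ 2) ^ 3 *ᴾ (oneᴾ +ᴾ z +ᴾ z ^ 2 +ᴾ z ^ 3 +ᴾ z ^ 4 +ᴾ z ^ 5 +ᴾ z ^ 6)
      +ᴾ (z ^ 4 *ᴾ (a *ᴾ z ^ 2 +ᴾ oneᴾ) +ᴾ z ^ 3 *ᴾ (b *ᴾ z ^ 3 +ᴾ oneᴾ) +ᴾ (c *ᴾ z ^ 6 +ᴾ oneᴾ))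
c-identity = solve-∀ F₂[x]-solver

^∸*^≡oneᴾ : ∀ {D} z {m j} → j ≤ m → z ^ m ≡ oneᴾ mod D → z ^ (m ∸ j) *ᴾ z ^ j ≡ oneᴾ mod D
^∸*^≡oneᴾ {D} z {m} {j} j≤m z^m≡1 = begin
  z ^ (m ∸ j) *ᴾ z ^ j  ≈⟨ ≋⇒≡ (^-homo-* z (m ∸ j) j) ⟨
  z ^ (m ∸ j + j)       ≡⟨ cong (z ^_) (ℕ.m∸n+n≡m j≤m) ⟩
  z ^ m                 ≈⟨ z^m≡1 ⟩
  oneᴾ                  ∎
  where open Modulo D

Φ₃³Φ₇ : Poly → Poly
Φ₃³Φ₇ z = geom z 3 ^ 3 *ᴾ geom z 7

z⁶c≡Φ₃³Φ₇ : ∀ {D} m z → 6 ≤ m → z ^ m ≡ oneᴾ mod D → z ^ 6 *ᴾ c[ m ] z ≡ Φ₃³Φ₇ z mod D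
z⁶c≡Φ₃³Φ₇ {D} m z 6≤m z^m≡1 = begin
  z ^ 6 *ᴾ c[ m ] z
    ≈⟨ ≋⇒≡ (c-identity z (z ^ (m ∸ 2)) (z ^ (m ∸ 3)) (z ^ (m ∸ 6))) ⟩
  Φ +ᴾ (z ^ 4 *ᴾ vanishing 2 +ᴾ z ^ 3 *ᴾ vanishing 3 +ᴾ vanishing 6)
    ≈⟨ +-congˡ Φ (+-cong (+-cong (*-congˡ (z ^ 4) (vanishes 2≤m)) (*-congˡ (z ^ 3) (vanishes 3≤m))) (vanishes 6≤m)) ⟩
  Φ +ᴾ (z ^ 4 *ᴾ [] +ᴾ z ^ 3 *ᴾ [] +ᴾ [])
    ≈⟨ ≋⇒≡ (drop-zeros Φ (z ^ 4) (z ^ 3)) ⟩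
  Φ ∎
  where
  open Modulo D
  Φ = Φ₃³Φ₇ z
  vanishing : ℕ → Poly
  vanishing j = z ^ (m ∸ j) *ᴾ z ^ j +ᴾ oneᴾ
  vanishes : ∀ {j} → j ≤ m → vanishing j ≡ [] mod D
  vanishes {j} j≤m = +≡[]⇐≡ (^∸*^≡oneᴾ z j≤m z^m≡1)
  2≤m = ℕ.≤-trans (ℕ.m≤m+n 2 4) 6≤m
  3≤m = ℕ.≤-trans (ℕ.m≤m+n 3 3) 6≤m
  drop-zeros : ∀ p q r → p +ᴾ (q *ᴾ [] +ᴾ r *ᴾ [] +ᴾ []) ≋ p
  drop-zeros = solve-∀ F₂[x]-solver

c-vanishes : ∀ {D} m z → 6 ≤ m → z ^ m ≡ oneᴾ mod D → Φ₃³Φ₇ z ≡ [] mod D → c[ m ] z ≡ [] mod D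
c-vanishes {D} m z 6≤m z^m≡1 Φ≡0 =
  invertible-cancel z⁶-invertible (≡-trans (z⁶c≡Φ₃³Φ₇ m z 6≤m z^m≡1) Φ≡0)
  where
  open Modulo D
  z⁶-invertible : Invertible D (z ^ 6)
  z⁶-invertible = z ^ (m ∸ 6) , ≡-trans (≋⇒≡ (*ᴾ-comm (z ^ 6) _)) (^∸*^≡oneᴾ z 6≤m z^m≡1)

Φ₃³Φ₇≡[]-if-Φ₃ : ∀ {D} z → geom z 3 ≡ [] mod D → Φ₃³Φ₇ z ≡ [] mod D
Φ₃³Φ₇≡[]-if-Φ₃ {D} z Φ₃≡0 = *-congʳ (geom z 7) (^-congˡ 3 Φ₃≡0)
  where open Modulo D

Φ₃³Φ₇≡[]-if-Φ₇ : ∀ {D} z → geom z 7 ≡ [] mod D → Φ₃³Φ₇ z ≡ [] mod D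
Φ₃³Φ₇≡[]-if-Φ₇ {D} z Φ₇≡0 = ≡-trans (*-congˡ (geom z 3 ^ 3) Φ₇≡0) (≋⇒≡ (*ᴾ-zeroʳ (geom z 3 ^ 3)))
  where open Modulo D

-- Degrees

VanishesFrom : ℕ → Poly → Set
VanishesFrom n p = ∀ j → n ≤ j → coeff p j ≡ false

record HasDegree (p : Poly) (n : ℕ) : Set where
  field
    leading : coeff p n ≡ true
    beyond  : VanishesFrom (suc n) p
open HasDegree

HasDegree-≋ : ∀ {p q n} → p ≋ q → HasDegree p n → HasDegree q n
HasDegree-≋ (coeffwise e) d = record
  { leading = ≡.trans (≡.sym (e _)) (leading d)
  ; beyond  = λ j n<j → ≡.trans (≡.sym (e j)) (beyond d j n<j)
  }

HasDegree-∷ : ∀ {a p n} → HasDegree p n → HasDegree (a ∷ p) (suc n)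
HasDegree-∷ d = record { leading = leading d ; beyond = λ { (suc j) (s≤s n<j) → beyond d j n<j } }

HasDegree-X^ : ∀ n → HasDegree (X^ n) n
HasDegree-X^ zero    = record { leading = refl ; beyond = λ { (suc j) _ → refl } }
HasDegree-X^ (suc n) = HasDegree-∷ (HasDegree-X^ n)

HasDegree-+ᴾ : ∀ {p q n} → VanishesFrom n p → HasDegree q n → HasDegree (p +ᴾ q) n
HasDegree-+ᴾ {p} {q} {n} p≈0 d = record
  { leading = ≡.trans (coeff-+ᴾ p q n) (cong₂ _xor_ (p≈0 n ℕ.≤-refl) (leading d))
  ; beyond  = λ j n<j → ≡.trans (coeff-+ᴾ p q j) (cong₂ _xor_ (p≈0 j (ℕ.<⇒≤ n<j)) (beyond d j n<j))
  }

HasDegree-*ᴾ : ∀ {p q a b} → HasDegree p a → HasDegree q b → HasDegree (p *ᴾ q) (a + b)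
HasDegree-*ᴾ {[]}    dp = contradiction (leading dp) λ ()
HasDegree-*ᴾ {t ∷ p} {q} {zero} dp dq = HasDegree-≋ (≋-sym t∷p*q≋q) dq
  where
  open SetoidReasoning ≋-setoid
  t∷p*q≋q : (t ∷ p) *ᴾ q ≋ q
  t∷p*q≋q = begin
    t ·ᴾ q +ᴾ (false ∷ p *ᴾ q)   ≈⟨ +ᴾ-cong (≋-reflexive (cong (_·ᴾ q) (leading dp))) (∷-congʳ (*ᴾ-congʳ q p≋[])) ⟩
    true ·ᴾ q +ᴾ (false ∷ [])    ≈⟨ +ᴾ-cong (true-·ᴾ q) x·[] ⟩
    q +ᴾ []                      ≈⟨ +ᴾ-identityʳ q ⟩
    q                            ∎
    where
    p≋[] : p ≋ []
    p≋[] = coeffwise λ j → beyond dp (suc j) (s≤s z≤n)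
HasDegree-*ᴾ {t ∷ p} {q} {suc a} {b} dp dq =
  HasDegree-+ᴾ t·q≈0 (HasDegree-∷ (HasDegree-*ᴾ dp′ dq))
  where
  dp′ : HasDegree p a
  dp′ = record { leading = leading dp ; beyond = λ j a<j → beyond dp (suc j) (s≤s a<j) }
  t·q≈0 : VanishesFrom (suc (a + b)) (t ·ᴾ q)
  t·q≈0 j a+b<j = ≡.trans (coeff-·ᴾ t q j)
    (≡.trans (cong (t ∧_) (beyond dq j (ℕ.≤-trans (s≤s (ℕ.m≤n+m b a)) a+b<j))) (∧-zeroʳ t))

≋[]⊎HasDegree : ∀ p → p ≋ [] ⊎ ∃ (HasDegree p)
≋[]⊎HasDegree []      = inj₁ ≋-refl
≋[]⊎HasDegree (t ∷ p) with ≋[]⊎HasDegree p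
... | inj₂ (n , d) = inj₂ (suc n , HasDegree-∷ d)
... | inj₁ p≋[] with t
...   | true  = inj₂ (0 , record { leading = refl ; beyond = λ { (suc j) _ → coeff-≡ p≋[] j } })
...   | false = inj₁ (≋-trans (∷-congʳ p≋[]) x·[])

¬∣ᴾoneᴾ : ∀ {p n} → HasDegree p (suc n) → ¬ p ∣ᴾ oneᴾ
¬∣ᴾoneᴾ {p} {n} dp (q , q*p≈1) with ≋[]⊎HasDegree q
... | inj₁ q≋[] = contradiction (≡.trans (≡.sym (coeff-≡ (*ᴾ-congʳ p q≋[]) 0)) (q*p≈1 0)) λ ()
... | inj₂ (b , dq) = contradiction (begin
  true                         ≡⟨ leading (HasDegree-*ᴾ dq dp) ⟨
  coeff (q *ᴾ p) (b + suc n)   ≡⟨ q*p≈1 (b + suc n) ⟩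
  coeff oneᴾ (b + suc n)       ≡⟨ cong (coeff oneᴾ) (ℕ.+-suc b n) ⟩
  false                        ∎) λ ()
  where open ≡.≡-Reasoning

HasDegree-geom : ∀ g n → HasDegree (geom (x ^ suc g) (suc n)) (n * suc g)
HasDegree-geom g zero    = HasDegree-X^ 0
HasDegree-geom g (suc n) = HasDegree-+ᴾ
  (λ j ng<j → beyond (HasDegree-geom g n) j (ℕ.≤-trans (s≤s (ℕ.m≤n+m (n * suc g) g)) ng<j))
  (HasDegree-≋ (X^-* (suc g) (suc n)) (HasDegree-X^ (suc n * suc g)))

geom-nonunit : ∀ g n .{{_ : NonZero g}} → ¬ geom (x ^ g) (suc (suc n)) ∣ᴾ oneᴾ
geom-nonunit (suc g) n = ¬∣ᴾoneᴾ (HasDegree-geom g (suc n))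

-- Arithmetic of the exponents

Bézout⇒linear-congruence : ∀ {d m a b} .{{_ : NonZero m}} → Bézout.Identity d m a → d ∣ b →
  ∃ λ e → ∃₂ λ s t → e * a + s * m ≡ b + t * m
Bézout⇒linear-congruence {d} {suc m′} {a} {b} (Bézout.-+ x y d+x*m≡y*a) (divides u b≡u*d) =
  u * y , 0 , u * x , (begin
    u * y * a + 0              ≡⟨ ℕ-Solver.solve (u ∷ y ∷ a ∷ []) ⟩
    u * (y * a)                ≡⟨ cong (u *_) d+x*m≡y*a ⟨
    u * (d + x * suc m′)       ≡⟨ ℕ-Solver.solve (u ∷ d ∷ x ∷ m′ ∷ []) ⟩
    u * d + u * x * suc m′     ≡⟨ cong (_+ u * x * suc m′) b≡u*d ⟨
    b + u * x * suc m′         ∎)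
  where open ≡.≡-Reasoning
-- Here y a ≡ −d, so y a (m − 1) ≡ d (mod m).
Bézout⇒linear-congruence {d} {suc m′} {a} {b} (Bézout.+- x y d+y*a≡x*m) (divides u b≡u*d) =
  u * y * m′ , u * x , u * y * a , (begin
    u * y * m′ * a + u * x * suc m′    ≡⟨ ℕ-Solver.solve (u ∷ y ∷ m′ ∷ a ∷ x ∷ []) ⟩
    u * (y * a * m′ + x * suc m′)      ≡⟨ cong (λ t → u * (y * a * m′ + t)) d+y*a≡x*m ⟨
    u * (y * a * m′ + (d + y * a))     ≡⟨ ℕ-Solver.solve (u ∷ y ∷ a ∷ m′ ∷ d ∷ []) ⟩
    u * d + u * y * a * suc m′         ≡⟨ cong (_+ u * y * a * suc m′) b≡u*d ⟨
    b + u * y * a * suc m′             ∎)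
  where open ≡.≡-Reasoning

linear-congruence : ∀ m a b .{{_ : NonZero m}} → gcd m a ∣ b → ∃ λ e → ∃₂ λ s t → e * a + s * m ≡ b + t * m
linear-congruence m a b = Bézout⇒linear-congruence (Bézout.identity (gcd-GCD m a))

prime∤⇒gcd≡1 : ∀ {c r} → Prime c → ¬ c ∣ r → gcd c r ≡ 1
prime∤⇒gcd≡1 {c} {r} p c∤r with prime⇒irreducible p (gcd[m,n]∣m c r)
... | inj₁ gcd≡1 = gcd≡1
... | inj₂ gcd≡c = contradiction (≡.subst (_∣ r) gcd≡c (gcd[m,n]∣n c r)) c∤r

gcd-nonZero : ∀ m k .{{_ : NonZero m}} → NonZero (gcd m k)
gcd-nonZero m k = ≢-nonZero (gcd[m,n]≢0 m k (inj₁ (≢-nonZero⁻¹ m)))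

-- gcd m k ∣ gcd m (c k) ∣ c · gcd m k, so for prime c the middle term is one of the outer two.
gcd-jump : ∀ {c} m k .{{_ : NonZero m}} → Prime c → gcd m (c * k) ≢ gcd m k →
  ∃₂ λ s r → m ≡ s * (c * gcd m k) × k ≡ r * gcd m k × ¬ c ∣ r
gcd-jump {c} m k p h≢g with gcd[m,n]∣m m (c * k) | gcd[m,n]∣n m k
... | divides s m≡s*h | divides r k≡r*g = s , r , ≡.trans m≡s*h (cong (s *_) h≡cg) , k≡r*g , c∤r
  where
  g = gcd m k
  h = gcd m (c * k)
  instance
    g≢0 : NonZero g
    g≢0 = gcd-nonZero m k
  h∣cg : h ∣ c * g
  h∣cg = ≡.subst (h ∣_) (≡.sym (c*gcd[m,n]≡gcd[cm,cn] c m k))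
    (gcd-greatest (∣n⇒∣m*n c (gcd[m,n]∣m m (c * k))) (gcd[m,n]∣n m (c * k)))
  h≡cg : h ≡ c * g
  h≡cg with gcd-greatest (gcd[m,n]∣m m k) (∣n⇒∣m*n c (gcd[m,n]∣n m k))
  ... | divides e h≡e*g with prime⇒irreducible p (*-cancelʳ-∣ {e} {c} g (≡.subst (_∣ c * g) h≡e*g h∣cg))
  ...   | inj₁ e≡1 = contradiction (≡.trans h≡e*g (≡.trans (cong (_* g) e≡1) (ℕ.*-identityˡ g))) h≢g
  ...   | inj₂ e≡c = ≡.trans h≡e*g (cong (_* g) e≡c)
  c∤r : ¬ c ∣ r
  c∤r c∣r = ¬prime[1] (≡.subst Prime c≡1 p)
    where
    cg∣g : c * g ∣ 1 * g
    cg∣g = ≡.subst (c * g ∣_) (≡.sym (ℕ.*-identityˡ g))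
      (gcd-greatest (divides s (≡.trans m≡s*h (cong (s *_) h≡cg)))
                    (≡.subst (c * g ∣_) (≡.sym k≡r*g) (*-monoˡ-∣ g c∣r)))
    c≡1 : c ≡ 1
    c≡1 = ∣1⇒≡1 (*-cancelʳ-∣ {c} {1} g cg∣g)

x^k∈⟨x^ck⟩ : ∀ {D} m k c .{{_ : NonZero m}} → x ^ m ≡ oneᴾ mod D → gcd m (c * k) ≡ gcd m k →
  ∃ λ E → ((x ^ k) ^ c) ^ E ≡ x ^ k mod D
x^k∈⟨x^ck⟩ {D} m k c x^m≡1 gcd≡ with linear-congruence m (c * k) k (≡.subst (_∣ k) (≡.sym gcd≡) (gcd[m,n]∣n m k))
... | E , s , t , eq = E , (begin
  ((x ^ k) ^ c) ^ E  ≈⟨ ≋⇒≡ (^-assocʳ (x ^ k) c E) ⟩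
  (x ^ k) ^ (c * E)  ≈⟨ ^^-periodic x m k (c * E) k s t x^m≡1 (≡.trans (cong (_+ s * m) (*-rotate k c E)) eq) ⟩
  x ^ k              ∎)
  where
  open Modulo D
  *-rotate : ∀ a b c → a * (b * c) ≡ c * (b * a)
  *-rotate = ℕ-Solver.solve-∀

coprime-if-gcds-agree : ∀ m k .{{_ : NonZero m}} → 6 ≤ m →
  gcd m (3 * k) ≡ gcd m k → gcd m (7 * k) ≡ gcd m k → GcdOne (subst^ k (cpoly m)) (X^ m +ᴾ oneᴾ)
coprime-if-gcds-agree m k 6≤m e₃ e₇ D D∣c D∣X =
  ≡[]⇒∣ᴾ (invertible-cancel Φ-invertible (≡-trans (*-identityʳ (Φ₃³Φ₇ z)) Φ≡0))
  where
  open Modulo D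
  z = x ^ k
  x^m≡1 : x ^ m ≡ oneᴾ mod D
  x^m≡1 = Equivalence.to (∣ᴾX^+1⇔x^≡1 m) D∣X
  z^m≡1 : z ^ m ≡ oneᴾ mod D
  z^m≡1 = ^^-periodic x m k m 0 0 k x^m≡1 (ℕ.+-identityʳ (k * m))
  Φ≡0 : Φ₃³Φ₇ z ≡ [] mod D
  Φ≡0 = begin
    Φ₃³Φ₇ z            ≈⟨ z⁶c≡Φ₃³Φ₇ m z 6≤m z^m≡1 ⟨
    z ^ 6 *ᴾ c[ m ] z  ≈⟨ *-congˡ (z ^ 6) (≡-trans (≋⇒≡ (≋-sym (subst^-cpoly m k))) (∣ᴾ⇒≡[] D∣c)) ⟩
    z ^ 6 *ᴾ []        ≈⟨ ≋⇒≡ (*ᴾ-zeroʳ (z ^ 6)) ⟩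
    []                 ∎
  geom-invertible′ : ∀ h → gcd m (suc (h * 2) * k) ≡ gcd m k → Invertible D (geom z (suc (h * 2)))
  geom-invertible′ h e = let E , z^cE≡z = x^k∈⟨x^ck⟩ m k (suc (h * 2)) x^m≡1 e in geom-invertible z h E z^cE≡z
  Φ₃-invertible : Invertible D (geom z 3)
  Φ₃-invertible = geom-invertible′ 1 e₃
  Φ₇-invertible : Invertible D (geom z 7)
  Φ₇-invertible = geom-invertible′ 3 e₇
  Φ-invertible : Invertible D (Φ₃³Φ₇ z)
  Φ-invertible = Invertible-* (Invertible-* (Invertible-* Φ₃-invertible Φ₃-invertible) Φ₃-invertible) Φ₇-invertible

common-factor : ∀ m k g s r E T₁ T₂ h → 6 ≤ m →
  (∀ {D} z → geom z (suc (h * 2)) ≡ [] mod D → Φ₃³Φ₇ z ≡ [] mod D) →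
  m ≡ s * (suc (h * 2) * g) → k ≡ r * g → E * r + T₁ * suc (h * 2) ≡ 1 + T₂ * suc (h * 2) →
  geom (x ^ g) (suc (h * 2)) ∣ᴾ subst^ k (cpoly m) × geom (x ^ g) (suc (h * 2)) ∣ᴾ X^ m +ᴾ oneᴾ
common-factor m k g s r E T₁ T₂ h 6≤m Φ₃³Φ₇≡[] m≡s*cg k≡r*g Er≡1 =
  ≡[]⇒∣ᴾ (≡-trans (≋⇒≡ (subst^-cpoly m k)) c[z]≡0) , Equivalence.from (∣ᴾX^+1⇔x^≡1 m) x^m≡1
  where
  c = suc (h * 2)
  y = x ^ g
  z = x ^ k
  open ≡.≡-Reasoning
  x^gc≡1 : x ^ (g * c) ≡ oneᴾ mod geom y c
  x^gc≡1 = ≡-trans (≋⇒≡ (≋-sym (^-assocʳ x g c))) (geom-root y c)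
  x^m≡1 : x ^ m ≡ oneᴾ mod geom y c
  x^m≡1 = ^-periodic x (g * c) m 0 0 s x^gc≡1 (begin
    m + 0        ≡⟨ ℕ.+-identityʳ m ⟩
    m            ≡⟨ m≡s*cg ⟩
    s * (c * g)  ≡⟨ cong (s *_) (ℕ.*-comm c g) ⟩
    s * (g * c)  ∎)
  z^m≡1 : z ^ m ≡ oneᴾ mod geom y c
  z^m≡1 = ^^-periodic x m k m 0 0 k x^m≡1 (ℕ.+-identityʳ (k * m))
  z^c≡1 : z ^ c ≡ oneᴾ mod geom y c
  z^c≡1 = ^^-periodic x (g * c) k c 0 0 r x^gc≡1 (begin
    k * c + 0        ≡⟨ cong (λ k → k * c + 0) k≡r*g ⟩
    r * g * c + 0    ≡⟨ ℕ.+-identityʳ (r * g * c) ⟩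
    r * g * c        ≡⟨ ℕ.*-assoc r g c ⟩
    r * (g * c)      ∎)
  factor-g : ∀ r g E T c → r * g * E + T * (g * c) ≡ (E * r + T * c) * g
  factor-g = ℕ-Solver.solve-∀
  expand-g : ∀ T c g → (1 + T * c) * g ≡ g + T * (g * c)
  expand-g = ℕ-Solver.solve-∀
  z^E≡y : z ^ E ≡ y mod geom y c
  z^E≡y = ^^-periodic x (g * c) k E g T₁ T₂ x^gc≡1 (begin
    k * E + T₁ * (g * c)      ≡⟨ cong (λ k → k * E + T₁ * (g * c)) k≡r*g ⟩
    r * g * E + T₁ * (g * c)  ≡⟨ factor-g r g E T₁ c ⟩
    (E * r + T₁ * c) * g      ≡⟨ cong (_* g) Er≡1 ⟩
    (1 + T₂ * c) * g          ≡⟨ expand-g T₂ c g ⟩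
    g + T₂ * (g * c)          ∎)
  c[z]≡0 : c[ m ] z ≡ [] mod geom y c
  c[z]≡0 = c-vanishes m z 6≤m z^m≡1
    (Φ₃³Φ₇≡[] z (geom-vanishes y z c E (y+oneᴾ-invertible y h) z^c≡1 z^E≡y))

gcds-agree-if-coprime : ∀ m k h .{{_ : NonZero m}} → Prime (suc (h * 2)) → 6 ≤ m →
  (∀ {D} z → geom z (suc (h * 2)) ≡ [] mod D → Φ₃³Φ₇ z ≡ [] mod D) →
  GcdOne (subst^ k (cpoly m)) (X^ m +ᴾ oneᴾ) → gcd m (suc (h * 2) * k) ≡ gcd m k
gcds-agree-if-coprime m k zero    p = contradiction p ¬prime[1]
gcds-agree-if-coprime m k (suc h) p 6≤m Φ₃³Φ₇≡[] coprime =
  decidable-stable (gcd m (c * k) ≟ gcd m k) λ jump →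
    let s , r , m≡s*cg , k≡r*g , c∤r = gcd-jump m k p jump
        E , T₁ , T₂ , Er≡1 = linear-congruence c r 1 (≡.subst (_∣ 1) (≡.sym (prime∤⇒gcd≡1 p c∤r)) ∣-refl)
        P∣c , P∣X = common-factor m k (gcd m k) s r E T₁ T₂ (suc h) 6≤m Φ₃³Φ₇≡[] m≡s*cg k≡r*g Er≡1
    in geom-nonunit (gcd m k) (suc (h * 2)) {{gcd-nonZero m k}} (coprime _ P∣c P∣X)
  where
  c = suc (suc h * 2)

proposition5 : (m k : ℕ) → 13 ≤ m → 1 ≤ k →
    GcdOne (subst^ k (cpoly m)) (X^ m +ᴾ oneᴾ) ⇔ (gcd m (3 * k) ≡ gcd m k × gcd m (7 * k) ≡ gcd m k)
proposition5 m k 13≤m _ = mk⇔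
  (λ coprime → gcds-agree-if-coprime m k 1 prime[3] 6≤m Φ₃³Φ₇≡[]-if-Φ₃ coprime
             , gcds-agree-if-coprime m k 3 prime[7] 6≤m Φ₃³Φ₇≡[]-if-Φ₇ coprime)
  (λ (e₃ , e₇) → coprime-if-gcds-agree m k 6≤m e₃ e₇)
  where
  instance
    m≢0 : NonZero m
    m≢0 = >-nonZero (ℕ.≤-trans (s≤s z≤n) 13≤m)
  6≤m : 6 ≤ m
  6≤m = ℕ.≤-trans (ℕ.m≤m+n 6 7) 13≤m
  prime[3] : Prime 3
  prime[3] = from-yes (prime? 3)
  prime[7] : Prime 7
  prime[7] = from-yes (prime? 7)
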